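{- Let $A$ and $B$ be nonempty finite multisets of positive integers such that $\{A,B\}$ is an irreducible pair. Then $|A|\leq \max(B)$ and $|B|\leq \max(A)$. Consequently, for every integer $k>1$, $\ell(k)=2k-1$.
   Context: For a finite multiset $S$, $|S|$ is the number of elements of $S$ counted with multiplicity, $\max(S)$ is its largest element, and $\Sigma S=\sum_{s\in S}s$ (with multiplicity). For nonempty finite multisets $A,B$ of positive integers, the (unordered) pair $\{A,B\}$ is called irreducible if $\Sigma A=\Sigma B$ and for every nonempty proper multisubsets $A'\subsetneq A$ and $B'\subsetneq B$ one has $\Sigma A'\neq \Sigma B'$. For a positive integer $k$, an irreducible pair $\{A,B\}$ is called $k$-irreducible if $\max(A\cup B)\leq k$. The length of $\{A,B\}$ is $\ell(A,B)=|A|+|B|$, and $\ell(k)$ denotes the maximum of $\ell(A,B)$ over all $k$-irreducible pairs $\{A,B\}$. -}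

module Defs where

open import Data.Nat using (ℕ; _<_; _≤_; _⊔_; _+_)
open import Data.List using (List; []; _++_; length; foldr)
open import Data.Nat.ListAction using (sum)
open import Data.List.Relation.Unary.All using (All)
open import Data.List.Relation.Binary.Sublist.Propositional using (_⊆_)
open import Data.List.Relation.Binary.Permutation.Propositional using (_↭_)
open import Data.Product using (Σ; ∃; _×_)
open import Relation.Nullary using (¬_)
open import Relation.Binary.PropositionalEquality using (_≡_; _≢_)

-- A finite multiset of naturals is represented by a list, considered up to
-- permutation (_↭_).  |S| = length S, ΣS = sum S.

-- max(S) (largest element; 0 for the empty list, never used on empty lists).
maxM : List ℕ → ℕ
maxM = foldr _⊔_ 0

_⊑_ : List ℕ → List ℕ → Set
A' ⊑ A = Σ (List ℕ) λ C → (C ⊆ A) × (A' ↭ C)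

_⊏_ : List ℕ → List ℕ → Set
A' ⊏ A = (A' ⊑ A) × ¬ (A' ↭ A)

PosMultiset : List ℕ → Set
PosMultiset A = (A ≢ []) × All (0 <_) A

Irreducible : List ℕ → List ℕ → Set
Irreducible A B =
  PosMultiset A × PosMultiset B × (sum A ≡ sum B) ×
  (∀ A' B' → A' ⊏ A → B' ⊏ B → A' ≢ [] → B' ≢ [] → sum A' ≢ sum B')

KIrreducible : ℕ → List ℕ → List ℕ → Set
KIrreducible k A B = Irreducible A B × (maxM (A ++ B) ≤ k)

len : List ℕ → List ℕ → ℕ
len A B = length A + length B

IsEll : ℕ → ℕ → Set
IsEll k n = (∃ λ A → ∃ λ B → KIrreducible k A B × (len A B ≡ n))
          × (∀ A B → KIrreducible k A B → len A B ≤ n)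

module Submission where

-- Part 1 is a pigeonhole argument on prefix sums (lists in any order).  Let
-- m = max B.  Each prefix sum a_i of A (i < |A|) is at most ΣB, so, the entries
-- of B being at most m, some prefix sum b_j of B overshoots it by an excess in
-- [0, m).  If |A| > m, two indices i < i' share an excess d.  Then j ≤ j' and
-- the segments A[i, i') and B[j, j') have equal sums; they are nonempty and
-- proper, contradicting irreducibility.
--
-- Part 2.  For a k-irreducible pair |A| ≤ max B ≤ k and |B| ≤ max A ≤ k, and
-- both equalities would give max A = max B = k, so the singletons {k} would
-- split the pair; hence ℓ ≤ 2k − 1.  Equality holds for k copies of k − 1
-- against k − 1 copies of k, as k − 1 and k are coprime.

open import Defs
open import Data.Nat using (ℕ; zero; suc; _+_; _*_; _∸_; _⊔_; _⊓_; _<_; _≤_; z≤n; z<s; s≤s⁻¹; >-nonZero; _≤?_)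
open import Data.Nat.Properties
open import Data.Nat.Divisibility using (_∣_; divides; ∣⇒≤)
open import Data.Nat.Coprimality using (Coprime; coprime-+; 1-coprimeTo; coprime-divisor)
open import Data.Nat.ListAction using (sum)
open import Data.Nat.ListAction.Properties using (sum-++; sum-↭)
open import Data.List using (List; []; _∷_; length; take; drop; replicate; _++_)
open import Data.List.Properties using (take++drop≡id; take-take; length-take; length-replicate)
open import Data.List.Relation.Unary.All as All using (All; []; _∷_)
open import Data.List.Relation.Unary.All.Properties using (++⁺; replicate⁺)
open import Data.List.Relation.Binary.Sublist.Propositional using (_⊆_; ⊆-trans; _∷_; _∷ʳ_; []; minimum)
open import Data.List.Relation.Binary.Sublist.Propositional.Properties using (All-resp-⊆; take-⊆; drop-⊆)
open import Data.List.Relation.Binary.Sublist.Heterogeneous.Properties using (length-mono-≤)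
open import Data.List.Relation.Binary.Permutation.Propositional using (_↭_; ↭-refl)
open import Data.List.Relation.Binary.Permutation.Propositional.Properties using (↭-length)
open import Data.Fin using (toℕ; fromℕ<)
open import Data.Fin.Properties using (pigeonhole; toℕ<n; fromℕ<-injective)
open import Data.Product using (_×_; _,_; ∃)
open import Data.Sum using (inj₁; inj₂)
open import Data.Empty using (⊥; ⊥-elim)
open import Relation.Nullary using (yes; no)
open import Relation.Binary.PropositionalEquality
open import Algebra.Properties.CommutativeSemigroup +-commutativeSemigroup using (xy∙z≈xz∙y)

Positive : List ℕ → Set
Positive = All (0 <_)

prefixSum : List ℕ → ℕ → ℕ
prefixSum xs i = sum (take i xs)

segment : ℕ → ℕ → List ℕ → List ℕ
segment i i' xs = drop i (take i' xs)

sum-take-drop : ∀ i xs → sum xs ≡ prefixSum xs i + sum (drop i xs)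
sum-take-drop i xs = trans (cong sum (sym (take++drop≡id i xs))) (sum-++ (take i xs) (drop i xs))

prefixSum-segment : ∀ {i i'} xs → i ≤ i' → prefixSum xs i' ≡ prefixSum xs i + sum (segment i i' xs)
prefixSum-segment {i} {i'} xs i≤i' = begin
  prefixSum xs i'                                          ≡⟨ sum-take-drop i (take i' xs) ⟩
  sum (take i (take i' xs)) + sum (segment i i' xs)        ≡⟨ cong (λ ys → sum ys + sum (segment i i' xs)) (take-take i i' xs) ⟩
  sum (take (i ⊓ i') xs) + sum (segment i i' xs)           ≡⟨ cong (λ n → prefixSum xs n + sum (segment i i' xs)) (m≤n⇒m⊓n≡m i≤i') ⟩
  prefixSum xs i + sum (segment i i' xs)                   ∎
  where open ≡-Reasoning

prefixSum-mono : ∀ {i i'} xs → i ≤ i' → prefixSum xs i ≤ prefixSum xs i'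
prefixSum-mono xs i≤i' = m+n≤o⇒m≤o _ (≤-reflexive (sym (prefixSum-segment xs i≤i')))

prefixSum-≤-sum : ∀ i xs → prefixSum xs i ≤ sum xs
prefixSum-≤-sum i xs = m+n≤o⇒m≤o _ (≤-reflexive (sym (sum-take-drop i xs)))

sum-drop-positive : ∀ {xs} → Positive xs → ∀ {i} → i < length xs → 0 < sum (drop i xs)
sum-drop-positive {x ∷ xs} (x>0 ∷ _) {zero} _ = ≤-trans x>0 (m≤m+n x (sum xs))
sum-drop-positive (_ ∷ xs>0) {suc i} i<n = sum-drop-positive xs>0 (s≤s⁻¹ i<n)

segment-positive : ∀ {xs} → Positive xs → ∀ {i i'} → i < i' → i' ≤ length xs → 0 < sum (segment i i' xs)
segment-positive {xs} xs>0 {i} {i'} i<i' i'≤n =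
  sum-drop-positive (All-resp-⊆ (take-⊆ i' xs) xs>0)
    (subst (i <_) (sym (trans (length-take i' xs) (m≤n⇒m⊓n≡m i'≤n))) i<i')

prefixSum-strict : ∀ {xs} → Positive xs → ∀ {i i'} → i < i' → i' ≤ length xs → prefixSum xs i < prefixSum xs i'
prefixSum-strict {xs} xs>0 i<i' i'≤n =
  subst (_ <_) (sym (prefixSum-segment xs (<⇒≤ i<i'))) (m<m+n _ (segment-positive xs>0 i<i' i'≤n))

prefixSum-<-sum : ∀ {xs} → Positive xs → ∀ {i} → i < length xs → prefixSum xs i < sum xs
prefixSum-<-sum {xs} xs>0 {i} i<n = subst (prefixSum xs i <_) (sym (sum-take-drop i xs)) (m<m+n _ (sum-drop-positive xs>0 i<n))

segment-⊆ : ∀ i i' xs → segment i i' xs ⊆ xs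
segment-⊆ i i' xs = ⊆-trans (drop-⊆ i (take i' xs)) (take-⊆ i' xs)

record Overshoot (m : ℕ) (xs : List ℕ) (s : ℕ) : Set where
  constructor overshoot
  field
    prefix   : ℕ
    excess   : ℕ
    excess<m : excess < m
    reaches  : prefixSum xs prefix ≡ s + excess

extend-overshoot : ∀ {m x xs s} → x ≤ s → Overshoot m xs (s ∸ x) → Overshoot m (x ∷ xs) s
extend-overshoot {x = x} {s = s} x≤s (overshoot j d d<m reaches) = overshoot (suc j) d d<m (begin
  x + prefixSum _ j   ≡⟨ cong (x +_) reaches ⟩
  x + (s ∸ x + d)     ≡⟨ sym (+-assoc x (s ∸ x) d) ⟩
  x + (s ∸ x) + d     ≡⟨ cong (_+ d) (m+[n∸m]≡n x≤s) ⟩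
  s + d               ∎)
  where open ≡-Reasoning

-- If all entries of xs are at most m > 0, every s ≤ Σxs is overshot by a prefix
-- sum of xs by less than m (the first prefix sum reaching s does it).
overshoot-exists : ∀ {m} xs → All (_≤ m) xs → 0 < m → ∀ s → s ≤ sum xs → Overshoot m xs s
overshoot-exists _ _ m>0 zero _ = overshoot 0 0 m>0 refl
overshoot-exists [] _ _ (suc s) ()
overshoot-exists (x ∷ xs) (x≤m ∷ xs≤m) m>0 (suc s) s≤Σ with suc s ≤? x
... | yes s≤x = overshoot 1 (x ∸ suc s) (<-≤-trans (∸-monoʳ-< z<s s≤x) x≤m)
                  (trans (+-identityʳ x) (sym (m+[n∸m]≡n s≤x)))
... | no s≰x = extend-overshoot x≤s (overshoot-exists xs xs≤m m>0 (suc s ∸ x) (m≤n+o⇒m∸n≤o (suc s) x s≤Σ))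
  where x≤s : x ≤ suc s
        x≤s = <⇒≤ (≰⇒> s≰x)

maxM-bound : ∀ xs → All (_≤ maxM xs) xs
maxM-bound [] = []
maxM-bound (x ∷ xs) = m≤m⊔n x (maxM xs) ∷ All.map (λ y≤ → ≤-trans y≤ (m≤n⊔m x (maxM xs))) (maxM-bound xs)

maxM-lub : ∀ {k} xs → All (_≤ k) xs → maxM xs ≤ k
maxM-lub [] [] = z≤n
maxM-lub (x ∷ xs) (x≤k ∷ xs≤k) = ⊔-lub x≤k (maxM-lub xs xs≤k)

maxM-++ : ∀ xs ys → maxM (xs ++ ys) ≡ maxM xs ⊔ maxM ys
maxM-++ [] ys = refl
maxM-++ (x ∷ xs) ys = trans (cong (x ⊔_) (maxM-++ xs ys)) (sym (⊔-assoc x (maxM xs) (maxM ys)))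

maxM-positive : ∀ {xs} → Positive xs → xs ≢ [] → 0 < maxM xs
maxM-positive [] xs≢[] = ⊥-elim (xs≢[] refl)
maxM-positive {x ∷ xs} (x>0 ∷ _) _ = ≤-trans x>0 (m≤m⊔n x (maxM xs))

maxM-⊆ : ∀ x xs → (maxM (x ∷ xs) ∷ []) ⊆ (x ∷ xs)
maxM-⊆ x [] rewrite ⊔-identityʳ x = refl ∷ []
maxM-⊆ x (y ∷ ys) with ⊔-sel x (maxM (y ∷ ys))
... | inj₁ max≡x rewrite max≡x = refl ∷ minimum (y ∷ ys)
... | inj₂ max≡rest rewrite max≡rest = x ∷ʳ maxM-⊆ y ys

⊏-by-sum : ∀ {C X} → C ⊆ X → sum C < sum X → C ⊏ X
⊏-by-sum C⊆X lt = (_ , C⊆X , ↭-refl) , λ C↭X → <-irrefl (sum-↭ C↭X) lt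

⊏-by-length : ∀ {C X} → C ⊆ X → length C < length X → C ⊏ X
⊏-by-length C⊆X lt = (_ , C⊆X , ↭-refl) , λ C↭X → <-irrefl (↭-length C↭X) lt

nonempty-by-sum : ∀ {X} → 0 < sum X → X ≢ []
nonempty-by-sum 0<0 refl = <-irrefl refl 0<0

nonempty-length : ∀ {A : Set} (xs : List A) → xs ≢ [] → 0 < length xs
nonempty-length [] xs≢[] = ⊥-elim (xs≢[] refl)
nonempty-length (_ ∷ _) _ = z<s

sum-replicate : ∀ n x → sum (replicate n x) ≡ n * x
sum-replicate zero x = refl
sum-replicate (suc n) x = cong (x +_) (sum-replicate n x)

sublist-replicate : ∀ {A : Set} {n} {x : A} {C} → C ⊆ replicate n x → C ≡ replicate (length C) x
sublist-replicate {n = zero} [] = refl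
sublist-replicate {n = suc n} (_ ∷ʳ C⊆) = sublist-replicate C⊆
sublist-replicate {n = suc n} (refl ∷ C⊆) = cong (_ ∷_) (sublist-replicate C⊆)

⊏-replicate : ∀ {n x} A' → A' ⊏ replicate n x → (length A' < n) × (sum A' ≡ length A' * x)
⊏-replicate {n} {x} A' ((C , C⊆ , A'↭C) , A'≉) = length< , sum≡
  where
    A'↭ : A' ↭ replicate (length A') x
    A'↭ = subst (λ l → A' ↭ replicate l x) (sym (↭-length A'↭C)) (subst (A' ↭_) (sublist-replicate C⊆) A'↭C)
    length≤ : length A' ≤ n
    length≤ = subst (_≤ n) (sym (↭-length A'↭C)) (subst (length C ≤_) (length-replicate n) (length-mono-≤ C⊆))
    length< : length A' < n
    length< = ≤∧≢⇒< length≤ (λ l≡n → A'≉ (subst (λ l → A' ↭ replicate l x) l≡n A'↭))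
    sum≡ : sum A' ≡ length A' * x
    sum≡ = trans (sum-↭ A'↭) (sum-replicate (length A') x)

equal-excess⇒equal-segments :
  ∀ {A B} → Positive A → ∀ {i i' j j' d} → i < i' → i' ≤ length A →
  prefixSum B j ≡ prefixSum A i + d → prefixSum B j' ≡ prefixSum A i' + d →
  sum (segment i i' A) ≡ sum (segment j j' B)
equal-excess⇒equal-segments {A} {B} A>0 {i} {i'} {j} {j'} {d} i<i' i'≤n bj bj' =
  +-cancelˡ-≡ (prefixSum B j) _ _ (begin
    prefixSum B j + sum (segment i i' A)            ≡⟨ cong (_+ _) bj ⟩
    prefixSum A i + d + sum (segment i i' A)        ≡⟨ xy∙z≈xz∙y (prefixSum A i) d _ ⟩
    prefixSum A i + sum (segment i i' A) + d        ≡⟨ cong (_+ d) (sym (prefixSum-segment A (<⇒≤ i<i'))) ⟩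
    prefixSum A i' + d                              ≡⟨ sym bj' ⟩
    prefixSum B j'                                  ≡⟨ prefixSum-segment B j≤j' ⟩
    prefixSum B j + sum (segment j j' B)            ∎)
  where
    open ≡-Reasoning
    -- b_j = a_i + d < a_i' + d = b_j', so the B-prefix cannot shrink.
    bj<bj' : prefixSum B j < prefixSum B j'
    bj<bj' = subst₂ _<_ (sym bj) (sym bj') (+-monoˡ-< d (prefixSum-strict A>0 i<i' i'≤n))
    j≤j' : j ≤ j'
    j≤j' = ≮⇒≥ (λ j'<j → <⇒≱ bj<bj' (prefixSum-mono B (<⇒≤ j'<j)))

irreducible⇒no-equal-segments :
  ∀ {A B} → Irreducible A B → ∀ {i i' j j'} → i < i' → i' < length A →
  sum (segment i i' A) ≢ sum (segment j j' B)
irreducible⇒no-equal-segments {A} {B} ((_ , A>0) , _ , ΣA≡ΣB , irr) {i} {i'} {j} {j'} i<i' i'<n seg≡ =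
  irr (segment i i' A) (segment j j' B)
      (⊏-by-sum (segment-⊆ i i' A) segA<ΣA)
      (⊏-by-sum (segment-⊆ j j' B) (subst₂ _<_ seg≡ ΣA≡ΣB segA<ΣA))
      (nonempty-by-sum segA>0) (nonempty-by-sum (subst (0 <_) seg≡ segA>0)) seg≡
  where
    segA>0 : 0 < sum (segment i i' A)
    segA>0 = segment-positive A>0 i<i' (<⇒≤ i'<n)
    segA<ΣA : sum (segment i i' A) < sum A
    segA<ΣA = ≤-<-trans (m+n≤o⇒n≤o _ (≤-reflexive (sym (prefixSum-segment A (<⇒≤ i<i')))))
                        (prefixSum-<-sum A>0 i'<n)

-- Pigeonhole on the excesses of the prefix sums a_0, …, a_{|A|-1}.
length≤maxM : ∀ A B → Irreducible A B → length A ≤ maxM B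
length≤maxM A B I@((_ , A>0) , (B≢[] , B>0) , ΣA≡ΣB , _) = ≮⇒≥ λ maxB<|A| →
  let (i , i' , i<i' , same) = pigeonhole maxB<|A| (λ i → fromℕ< (excess<m (cover (toℕ i))))
  in collide i<i' (toℕ<n i') (fromℕ<-injective _ _ _ _ same)
  where
    open Overshoot
    cover : ∀ i → Overshoot (maxM B) B (prefixSum A i)
    cover i = overshoot-exists B (maxM-bound B) (maxM-positive B>0 B≢[]) (prefixSum A i)
                (subst (prefixSum A i ≤_) ΣA≡ΣB (prefixSum-≤-sum i A))
    collide : ∀ {i i'} → i < i' → i' < length A → excess (cover i) ≡ excess (cover i') → ⊥
    collide {i} {i'} i<i' i'<n same =
      irreducible⇒no-equal-segments I {j = prefix (cover i)} {j' = prefix (cover i')} i<i' i'<n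
        (equal-excess⇒equal-segments {A} {B} A>0 {j = prefix (cover i)} {j' = prefix (cover i')}
           i<i' (<⇒≤ i'<n) (reaches (cover i))
           (trans (reaches (cover i')) (cong (prefixSum A i' +_) (sym same))))

irreducible-sym : ∀ {A B} → Irreducible A B → Irreducible B A
irreducible-sym (a , b , ΣA≡ΣB , irr) =
  b , a , sym ΣA≡ΣB , λ B' A' B'⊏ A'⊏ B'≢[] A'≢[] e → irr A' B' A'⊏ B'⊏ A'≢[] B'≢[] (sym e)

-- Two sides of an irreducible pair, each with at least two elements, have
-- different maxima: otherwise the two singletons {max} would split the pair.
irreducible⇒maxM≢ : ∀ {A B} → Irreducible A B → 1 < length A → 1 < length B → maxM A ≢ maxM B
irreducible⇒maxM≢ {x ∷ xs} {y ∷ ys} (_ , _ , _ , irr) 1<|A| 1<|B| max≡ =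
  irr (maxM (x ∷ xs) ∷ []) (maxM (y ∷ ys) ∷ [])
      (⊏-by-length (maxM-⊆ x xs) 1<|A|) (⊏-by-length (maxM-⊆ y ys) 1<|B|)
      (λ ()) (λ ()) (cong (_+ 0) max≡)
irreducible⇒maxM≢ {[]} ((A≢[] , _) , _) = ⊥-elim (A≢[] refl)
irreducible⇒maxM≢ {_ ∷ _} {[]} (_ , (B≢[] , _) , _) = ⊥-elim (B≢[] refl)

+-≤-2k-1 : ∀ {a b k} → a ≤ k → b ≤ k → (a ≡ k → b ≡ k → ⊥) → a + b ≤ 2 * k ∸ 1
+-≤-2k-1 {a} {b} {k} a≤k b≤k not-both = <⇒≤pred (subst (a + b <_) (cong (k +_) (sym (+-identityʳ k))) a+b<k+k)
  where
    a+b<k+k : a + b < k + k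
    a+b<k+k with m≤n⇒m<n∨m≡n a≤k | m≤n⇒m<n∨m≡n b≤k
    ... | inj₁ a<k | _        = +-mono-<-≤ a<k b≤k
    ... | inj₂ _   | inj₁ b<k = +-mono-≤-< a≤k b<k
    ... | inj₂ a≡k | inj₂ b≡k = ⊥-elim (not-both a≡k b≡k)

len≤2k-1 : ∀ k → 1 < k → ∀ A B → KIrreducible k A B → len A B ≤ 2 * k ∸ 1
len≤2k-1 k 1<k A B (I , max≤k) = +-≤-2k-1 (≤-trans |A|≤maxB maxB≤k) (≤-trans |B|≤maxA maxA≤k) not-both
  where
    maxA⊔maxB≤k : maxM A ⊔ maxM B ≤ k
    maxA⊔maxB≤k = subst (_≤ k) (maxM-++ A B) max≤k
    maxA≤k : maxM A ≤ k
    maxA≤k = m⊔n≤o⇒m≤o (maxM A) (maxM B) maxA⊔maxB≤k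
    maxB≤k : maxM B ≤ k
    maxB≤k = m⊔n≤o⇒n≤o (maxM A) (maxM B) maxA⊔maxB≤k
    |A|≤maxB : length A ≤ maxM B
    |A|≤maxB = length≤maxM A B I
    |B|≤maxA : length B ≤ maxM A
    |B|≤maxA = length≤maxM B A (irreducible-sym I)
    -- If |A| = |B| = k then max A = max B = k, which irreducibility forbids.
    not-both : length A ≡ k → length B ≡ k → ⊥
    not-both |A|≡k |B|≡k = irreducible⇒maxM≢ I (subst (1 <_) (sym |A|≡k) 1<k) (subst (1 <_) (sym |B|≡k) 1<k)
      (trans (≤-antisym maxA≤k (subst (_≤ maxM A) |B|≡k |B|≤maxA))
             (sym (≤-antisym maxB≤k (subst (_≤ maxM B) |A|≡k |A|≤maxB))))

-- Since m and m + 1 are coprime, j·m = i·(m + 1) forces m + 1 ∣ j, so j = 0 or j > m.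
multiples-of-consecutive : ∀ m j i → 0 < j → j < suc m → j * m ≢ i * suc m
multiples-of-consecutive m j i 0<j j<1+m jm≡ = <⇒≱ j<1+m (∣⇒≤ {{>-nonZero 0<j}} 1+m∣j)
  where
    coprime : Coprime (suc m) m
    coprime = subst (λ n → Coprime n m) (+-comm m 1) (coprime-+ (1-coprimeTo m))
    1+m∣j : suc m ∣ j
    1+m∣j = coprime-divisor coprime (divides i (trans (*-comm m j) jm≡))

replicate-irreducible : ∀ m → 0 < m → Irreducible (replicate (suc m) m) (replicate m (suc m))
replicate-irreducible m@(suc _) 0<m = ((λ ()) , replicate⁺ (suc m) 0<m) , ((λ ()) , replicate⁺ m z<s) , sums≡ , no-split
  where
    sums≡ : sum (replicate (suc m) m) ≡ sum (replicate m (suc m))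
    sums≡ = trans (sum-replicate (suc m) m) (trans (*-comm (suc m) m) (sym (sum-replicate m (suc m))))
    no-split : ∀ A' B' → A' ⊏ replicate (suc m) m → B' ⊏ replicate m (suc m) → A' ≢ [] → B' ≢ [] → sum A' ≢ sum B'
    no-split A' B' A'⊏ B'⊏ A'≢[] _ ΣA'≡ΣB' with ⊏-replicate A' A'⊏ | ⊏-replicate B' B'⊏
    ... | |A'|<1+m , ΣA' | _ , ΣB' =
      multiples-of-consecutive m (length A') (length B') (nonempty-length A' A'≢[]) |A'|<1+m
        (trans (sym ΣA') (trans ΣA'≡ΣB' ΣB'))

ℓ-attained : ∀ k → 1 < k → ∃ λ A → ∃ λ B → KIrreducible k A B × (len A B ≡ 2 * k ∸ 1)
ℓ-attained (suc m) 1<k =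
  replicate (suc m) m , replicate m (suc m) , (replicate-irreducible m (s≤s⁻¹ 1<k) , max≤k) , length≡
  where
    max≤k : maxM (replicate (suc m) m ++ replicate m (suc m)) ≤ suc m
    max≤k = maxM-lub _ (++⁺ (replicate⁺ (suc m) (n≤1+n m)) (replicate⁺ m ≤-refl))
    length≡ : len (replicate (suc m) m) (replicate m (suc m)) ≡ 2 * suc m ∸ 1
    length≡ = trans (cong₂ _+_ (length-replicate (suc m)) (length-replicate m))
                    (trans (+-comm (suc m) m) (cong (m +_) (cong suc (sym (+-identityʳ m)))))

theorem1 : ((A B : List ℕ) → Irreducible A B → (length A ≤ maxM B) × (length B ≤ maxM A))
    × ((k : ℕ) → 1 < k → IsEll k (2 * k ∸ 1))
theorem1 = (λ A B I → length≤maxM A B I , length≤maxM B A (irreducible-sym I))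
         , (λ k 1<k → ℓ-attained k 1<k , len≤2k-1 k 1<k)
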